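{- Let $d\ge 1$ and let $U \subset \mathbb{Z}^d$ be finite and odd. Then for every unit vector $s \in \mathbb{Z}^d$, \[ |\partial^s U| = |\mathrm{Odd} \cap U| - |\mathrm{Even} \cap U| = \tfrac{|\partial U|}{2d} ,\] where $\partial^s U := \{v \in U : v+s \notin U\}$.
   Context: $\mathbb{Z}^d$ is viewed as a graph with nearest-neighbor adjacency. $\mathrm{Odd}$ ($\mathrm{Even}$) is the set of vertices at odd (even) graph distance from the origin. $\partial U$ is the set of edges with exactly one endpoint in $U$. A set $U$ is odd if every vertex of $U$ that is adjacent to a vertex outside $U$ is odd. A unit vector is $\pm e_i$ for a standard basis vector $e_i$. -}

module Defs where

open import Data.Nat as ℕ using (ℕ; _%_)
open import Data.Integer as ℤ using (ℤ; ∣_∣; +_)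
open import Data.Fin as Fin using (Fin)
open import Data.Vec using (Vec; tabulate; zipWith; foldr; map)
open import Data.Vec.Properties using (≡-dec)
open import Data.List as List using (List; filter; length; concatMap; allFin)
import Data.List.Membership.DecPropositional as DecMem
open import Data.Product using (_×_; _,_; ∃; proj₁; proj₂)
open import Data.Sum using (_⊎_)
open import Data.Bool using (if_then_else_)
import Relation.Nullary
open import Relation.Nullary using (¬?; ⌊_⌋)
open import Relation.Binary.PropositionalEquality using (_≡_)

Point : ℕ → Set
Point d = Vec ℤ d

_≟ᵖ_ : ∀ {d} → (u v : Point d) → Relation.Nullary.Dec (u ≡ v)
_≟ᵖ_ {d} = ≡-dec ℤ._≟_

_∈_ : ∀ {d} → Point d → List (Point d) → Set
_∈_ {d} = DecMem._∈_ (_≟ᵖ_ {d})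

_∉_ : ∀ {d} → Point d → List (Point d) → Set
_∉_ {d} = DecMem._∉_ (_≟ᵖ_ {d})

_∈?_ : ∀ {d} (v : Point d) (U : List (Point d)) → Relation.Nullary.Dec (v ∈ U)
_∈?_ {d} = DecMem._∈?_ (_≟ᵖ_ {d})

_⊕_ : ∀ {d} → Point d → Point d → Point d
_⊕_ = zipWith ℤ._+_

e : ∀ {d} → Fin d → Point d
e i = tabulate (λ j → if ⌊ i Fin.≟ j ⌋ then ℤ.1ℤ else ℤ.0ℤ)

neg : ∀ {d} → Point d → Point d
neg = map (λ x → ℤ.- x)

IsUnit : ∀ {d} → Point d → Set
IsUnit {d} s = ∃ λ (i : Fin d) → (s ≡ e i) ⊎ (s ≡ neg (e i))

units : ∀ d → List (Point d)
units d = concatMap (λ i → e i List.∷ neg (e i) List.∷ List.[]) (allFin d)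

-- graph distance from the origin in the nearest-neighbour graph ℤ^d (ℓ¹ norm)
dist0 : ∀ {d} → Point d → ℕ
dist0 v = foldr (λ _ → ℕ) (λ x acc → ∣ x ∣ ℕ.+ acc) 0 v

IsOdd : ∀ {d} → Point d → Set
IsOdd v = dist0 v % 2 ≡ 1

IsEven : ∀ {d} → Point d → Set
IsEven v = dist0 v % 2 ≡ 0

-- A finite set U ⊂ ℤ^d is represented by a duplicate-free list.
-- U is odd: every vertex of U adjacent to a vertex outside U is odd.
OddSet : ∀ {d} → List (Point d) → Set
OddSet {d} U = ∀ v w → v ∈ U → w ∉ U → IsUnit (w ⊕ neg v) → IsOdd v

∂ˢcard : ∀ {d} → Point d → List (Point d) → ℕ
∂ˢcard s U = length (filter (λ v → ¬? ((v ⊕ s) ∈? U)) U)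

oddCard : ∀ {d} → List (Point d) → ℕ
oddCard U = length (filter (λ v → (dist0 v % 2) ℕ.≟ 1) U)

evenCard : ∀ {d} → List (Point d) → ℕ
evenCard U = length (filter (λ v → (dist0 v % 2) ℕ.≟ 0) U)

-- |∂U|: each edge with exactly one endpoint in U is counted once, via its
-- orientation (u , w) with u ∈ U, w ∉ U; w ranges over the 2d neighbours u + s.
∂card : ∀ {d} → List (Point d) → ℕ
∂card {d} U =
  length (filter (λ p → ¬? ((proj₁ p ⊕ proj₂ p) ∈? U))
                 (concatMap (λ u → List.map (u ,_) (units d)) U))

-- An s-edge {v, v + s} has exactly one even endpoint, and every even vertex of the odd
-- set U is interior, so it lies on exactly two s-edges inside U (towards v - s and v + s).
-- Hence #{v ∈ U : v + s ∈ U} = 2 |Even ∩ U|, and the remaining |U| - 2 |Even ∩ U| =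
-- |Odd ∩ U| - |Even ∩ U| vertices form ∂ˢ U. As this does not depend on s, double counting
-- the boundary edges (v , v + s) over the 2d unit vectors s gives |∂U| = 2d |∂ˢ U|.
module Submission where

open import Defs
open import Data.Nat using (ℕ; _≤_; _*_)
open import Data.Integer using (+_; _-_)
open import Data.List using (List)
open import Data.List.Relation.Unary.Unique.Propositional using (Unique)
open import Data.Product using (_×_)
open import Relation.Binary.PropositionalEquality using (_≡_)

open import Data.Bool using (if_then_else_)
open import Data.Empty using (⊥-elim)
open import Data.Fin as Fin using (Fin)
open import Data.Integer as ℤ using (∣_∣; -[1+_])
import Data.Integer.Properties as ℤ
open import Data.List using ([]; _∷_; [_]; _++_; length; map; filter; concatMap; allFin)
open import Data.List.Membership.Propositional using () renaming (_∈_ to _∈ᴸ_)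
open import Data.List.Membership.Propositional.Properties
  using (∈-filter⁺; ∈-filter⁻; ∈-map⁺; ∈-map⁻)
open import Data.List.Membership.Propositional.Properties.WithK using (unique∧set⇒bag)
open import Data.List.Properties
  using (length-map; length-tabulate; map-++; map-∘; map-cong; map-cong-local; filter-≐)
open import Data.List.Relation.Binary.BagAndSetEquality using (_∼[_]_; set; ∼bag⇒↭)
open import Data.List.Relation.Binary.Permutation.Propositional.Properties using (↭-length)
open import Data.List.Relation.Unary.All as All using (All; []; _∷_)
open import Data.List.Relation.Unary.All.Properties using (concat⁺; map⁺)
import Data.List.Relation.Unary.Unique.Propositional.Properties as Unique
open import Data.Nat as ℕ using (zero; suc; _+_; _∸_; _%_; s≤s)
open import Data.Nat.DivMod using ([m+n]%n≡m%n; m%n<n)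
open import Data.Nat.ListAction using (sum)
open import Data.Nat.ListAction.Properties using (sum-++)
import Data.Nat.Properties as ℕ
open import Data.Product using (_,_; proj₁; proj₂)
open import Data.Sum using (inj₁; inj₂)
open import Data.Vec using (_∷_; []; tabulate)
open import Data.Vec.Properties using (tabulate-cong)
open import Function using (id; _∘_)
open import Function.Bundles using (mk⇔)
open import Relation.Binary.PropositionalEquality
  using (refl; sym; trans; cong; cong₂; subst; _≢_; module ≡-Reasoning)
open import Relation.Nullary using (yes; no; ⌊_⌋)
open import Relation.Unary using (Decidable; ∁; _≐_)
open import Relation.Unary.Properties using (∁?)

open import Algebra.Properties.CommutativeSemigroup ℕ.+-commutativeSemigroup
  using () renaming (interchange to +-interchange)
open import Algebra.Properties.AbelianGroup ℤ.+-0-abelianGroup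
  using (xyx⁻¹≈y; //-rightDividesˡ; //-rightDividesʳ)

private
  variable
    A B : Set
    d : ℕ

length-filter-partition : {P : A → Set} (P? : Decidable P) (xs : List A) →
  length xs ≡ length (filter P? xs) + length (filter (∁? P?) xs)
length-filter-partition P? [] = refl
length-filter-partition P? (x ∷ xs) with P? x
... | yes _ = cong suc (length-filter-partition P? xs)
... | no _  = trans (cong suc (length-filter-partition P? xs)) (sym (ℕ.+-suc _ _))

unique∧set⇒length≡ : {xs ys : List A} → Unique xs → Unique ys → xs ∼[ set ] ys →
  length xs ≡ length ys
unique∧set⇒length≡ xs! ys! xs∼ys = ↭-length (∼bag⇒↭ (unique∧set⇒bag xs! ys! xs∼ys))

sum-map-+ : (f g : A → ℕ) (xs : List A) →
  sum (map (λ x → f x + g x) xs) ≡ sum (map f xs) + sum (map g xs)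
sum-map-+ f g [] = refl
sum-map-+ f g (x ∷ xs) =
  trans (cong (_+_ (f x + g x)) (sum-map-+ f g xs)) (+-interchange (f x) (g x) _ _)

sum-map-const : (c : ℕ) (xs : List A) → sum (map (λ _ → c) xs) ≡ length xs * c
sum-map-const c [] = refl
sum-map-const c (x ∷ xs) = cong (_+_ c) (sum-map-const c xs)

sum-map-concatMap : (h : B → ℕ) (g : A → List B) (xs : List A) →
  sum (map h (concatMap g xs)) ≡ sum (map (λ x → sum (map h (g x))) xs)
sum-map-concatMap h g [] = refl
sum-map-concatMap h g (x ∷ xs) = begin
  sum (map h (g x ++ concatMap g xs))
    ≡⟨ cong sum (map-++ h (g x) _) ⟩
  sum (map h (g x) ++ map h (concatMap g xs))
    ≡⟨ sum-++ (map h (g x)) _ ⟩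
  sum (map h (g x)) + sum (map h (concatMap g xs))
    ≡⟨ cong (_+_ (sum (map h (g x)))) (sum-map-concatMap h g xs) ⟩
  sum (map (λ x → sum (map h (g x))) (x ∷ xs)) ∎
  where open ≡-Reasoning

sum-map-comm : (f : A → B → ℕ) (xs : List A) (ys : List B) →
  sum (map (λ x → sum (map (f x) ys)) xs) ≡ sum (map (λ y → sum (map (λ x → f x y) xs)) ys)
sum-map-comm f [] ys = sym (trans (sum-map-const 0 ys) (ℕ.*-zeroʳ (length ys)))
sum-map-comm f (x ∷ xs) ys =
  trans (cong (_+_ (sum (map (f x) ys))) (sum-map-comm f xs ys))
        (sym (sum-map-+ (f x) (λ y → sum (map (λ x → f x y) xs)) ys))

length-filter-as-sum : {P : B → Set} (P? : Decidable P) (f : A → B) (xs : List A) →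
  length (filter (P? ∘ f) xs) ≡ sum (map (λ x → length (filter P? [ f x ])) xs)
length-filter-as-sum P? f [] = refl
length-filter-as-sum P? f (x ∷ xs) with P? (f x)
... | yes _ = cong suc (length-filter-as-sum P? f xs)
... | no _  = length-filter-as-sum P? f xs

length-filter-pairs : {R : A × B → Set} (R? : Decidable R) (xs : List A) (ys : List B) →
  length (filter R? (concatMap (λ x → map (x ,_) ys) xs)) ≡
  sum (map (λ y → length (filter (λ x → R? (x , y)) xs)) ys)
length-filter-pairs R? xs ys = begin
  length (filter R? (concatMap (λ x → map (x ,_) ys) xs))
    ≡⟨ length-filter-as-sum R? id (concatMap (λ x → map (x ,_) ys) xs) ⟩
  sum (map occurs (concatMap (λ x → map (x ,_) ys) xs))
    ≡⟨ sum-map-concatMap occurs _ xs ⟩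
  sum (map (λ x → sum (map occurs (map (x ,_) ys))) xs)
    ≡⟨ cong sum (map-cong (λ x → cong sum (sym (map-∘ ys))) xs) ⟩
  sum (map (λ x → sum (map (λ y → occurs (x , y)) ys)) xs)
    ≡⟨ sum-map-comm (λ x y → occurs (x , y)) xs ys ⟩
  sum (map (λ y → sum (map (λ x → occurs (x , y)) xs)) ys)
    ≡⟨ cong sum (map-cong (λ y → sym (length-filter-as-sum R? (_, y) xs)) ys) ⟩
  sum (map (λ y → length (filter (λ x → R? (x , y)) xs)) ys) ∎
  where
  open ≡-Reasoning
  occurs : _ → ℕ
  occurs p = length (filter R? [ p ])

⊕-neg-cancelʳ : (v s : Point d) → (v ⊕ s) ⊕ neg s ≡ v
⊕-neg-cancelʳ [] [] = refl
⊕-neg-cancelʳ (x ∷ v) (y ∷ s) = cong₂ _∷_ (//-rightDividesʳ y x) (⊕-neg-cancelʳ v s)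

neg-⊕-cancelʳ : (v s : Point d) → (v ⊕ neg s) ⊕ s ≡ v
neg-⊕-cancelʳ [] [] = refl
neg-⊕-cancelʳ (x ∷ v) (y ∷ s) = cong₂ _∷_ (//-rightDividesˡ y x) (neg-⊕-cancelʳ v s)

⊕-neg-cancelˡ : (v t : Point d) → (v ⊕ t) ⊕ neg v ≡ t
⊕-neg-cancelˡ [] [] = refl
⊕-neg-cancelˡ (x ∷ v) (y ∷ t) = cong₂ _∷_ (xyx⁻¹≈y x y) (⊕-neg-cancelˡ v t)

⊕-injectiveˡ : (s : Point d) {v w : Point d} → v ⊕ s ≡ w ⊕ s → v ≡ w
⊕-injectiveˡ s {v} {w} eq =
  trans (sym (⊕-neg-cancelʳ v s)) (trans (cong (_⊕ neg s) eq) (⊕-neg-cancelʳ w s))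

neg-involutive : (s : Point d) → neg (neg s) ≡ s
neg-involutive [] = refl
neg-involutive (x ∷ s) = cong₂ _∷_ (ℤ.neg-involutive x) (neg-involutive s)

IsUnit-neg : {s : Point d} → IsUnit s → IsUnit (neg s)
IsUnit-neg (i , inj₁ refl) = i , inj₂ refl
IsUnit-neg (i , inj₂ refl) = i , inj₁ (neg-involutive (e i))

units-IsUnit : All IsUnit (units d)
units-IsUnit {d} =
  concat⁺ (map⁺ (All.universal (λ i → (i , inj₁ refl) ∷ (i , inj₂ refl) ∷ []) (allFin d)))

length-units : ∀ d → length (units d) ≡ 2 * d
length-units d = trans (length-pairs (allFin d)) (cong (_*_ 2) (length-tabulate {n = d} id))
  where
  length-pairs : (is : List (Fin d)) →
    length (concatMap (λ i → e i ∷ neg (e i) ∷ []) is) ≡ 2 * length is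
  length-pairs [] = refl
  length-pairs (i ∷ is) =
    trans (cong (_+_ 2) (length-pairs is)) (sym (ℕ.*-suc 2 (length is)))

data DifferByOne : ℕ → ℕ → Set where
  up   : ∀ n → DifferByOne (suc n) n
  down : ∀ n → DifferByOne n (suc n)

DifferByOne-+ˡ : ∀ c {a b} → DifferByOne a b → DifferByOne (c + a) (c + b)
DifferByOne-+ˡ c (up n)   = subst (λ m → DifferByOne m (c + n)) (sym (ℕ.+-suc c n)) (up (c + n))
DifferByOne-+ˡ c (down n) = subst (DifferByOne (c + n)) (sym (ℕ.+-suc c n)) (down (c + n))

DifferByOne-+ʳ : ∀ c {a b} → DifferByOne a b → DifferByOne (a + c) (b + c)
DifferByOne-+ʳ c (up n)   = up (n + c)
DifferByOne-+ʳ c (down n) = down (n + c)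

DifferByOne-∣i+1∣ : ∀ i → DifferByOne ∣ i ℤ.+ ℤ.1ℤ ∣ ∣ i ∣
DifferByOne-∣i+1∣ (+ n)        = subst (λ m → DifferByOne m n) (ℕ.+-comm 1 n) (up n)
DifferByOne-∣i+1∣ -[1+ zero ]  = down 0
DifferByOne-∣i+1∣ -[1+ suc n ] = down (suc n)

DifferByOne-∣i-1∣ : ∀ i → DifferByOne ∣ i ℤ.+ ℤ.-1ℤ ∣ ∣ i ∣
DifferByOne-∣i-1∣ (+ zero)  = up 0
DifferByOne-∣i-1∣ (+ suc n) = down n
DifferByOne-∣i-1∣ -[1+ n ]  =
  subst (λ m → DifferByOne (suc (suc m)) (suc n)) (sym (ℕ.+-identityʳ n)) (up (suc n))

e-suc : (i : Fin d) → e (Fin.suc i) ≡ ℤ.0ℤ ∷ e i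
e-suc i = cong (ℤ.0ℤ ∷_) (tabulate-cong λ j →
  cong (λ b → if b then ℤ.1ℤ else ℤ.0ℤ) (⌊suc≟suc⌋ i j))
  where
  ⌊suc≟suc⌋ : (i j : Fin d) → ⌊ Fin.suc i Fin.≟ Fin.suc j ⌋ ≡ ⌊ i Fin.≟ j ⌋
  ⌊suc≟suc⌋ i j with i Fin.≟ j
  ... | yes _ = refl
  ... | no _  = refl

⊕-zeros : (v : Point d) → v ⊕ tabulate (λ _ → ℤ.0ℤ) ≡ v
⊕-zeros [] = refl
⊕-zeros (x ∷ v) = cong₂ _∷_ (ℤ.+-identityʳ x) (⊕-zeros v)

⊕-neg-zeros : (v : Point d) → v ⊕ neg (tabulate (λ _ → ℤ.0ℤ)) ≡ v
⊕-neg-zeros [] = refl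
⊕-neg-zeros (x ∷ v) = cong₂ _∷_ (ℤ.+-identityʳ x) (⊕-neg-zeros v)

dist0-⊕-0∷ : ∀ x (v t : Point d) → DifferByOne (dist0 (v ⊕ t)) (dist0 v) →
  DifferByOne (dist0 ((x ∷ v) ⊕ (ℤ.0ℤ ∷ t))) (dist0 (x ∷ v))
dist0-⊕-0∷ x v t step rewrite ℤ.+-identityʳ x = DifferByOne-+ˡ ∣ x ∣ step

dist0-⊕-e : (i : Fin d) (v : Point d) → DifferByOne (dist0 (v ⊕ e i)) (dist0 v)
dist0-⊕-e Fin.zero (x ∷ v) rewrite ⊕-zeros v = DifferByOne-+ʳ (dist0 v) (DifferByOne-∣i+1∣ x)
dist0-⊕-e (Fin.suc i) (x ∷ v) =
  subst (λ t → DifferByOne (dist0 ((x ∷ v) ⊕ t)) (dist0 (x ∷ v))) (sym (e-suc i))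
        (dist0-⊕-0∷ x v (e i) (dist0-⊕-e i v))

dist0-⊕-neg-e : (i : Fin d) (v : Point d) → DifferByOne (dist0 (v ⊕ neg (e i))) (dist0 v)
dist0-⊕-neg-e Fin.zero (x ∷ v) rewrite ⊕-neg-zeros v =
  DifferByOne-+ʳ (dist0 v) (DifferByOne-∣i-1∣ x)
dist0-⊕-neg-e (Fin.suc i) (x ∷ v) =
  subst (λ t → DifferByOne (dist0 ((x ∷ v) ⊕ neg t)) (dist0 (x ∷ v))) (sym (e-suc i))
        (dist0-⊕-0∷ x v (neg (e i)) (dist0-⊕-neg-e i v))

dist0-⊕-unit : {t : Point d} → IsUnit t → (v : Point d) → DifferByOne (dist0 (v ⊕ t)) (dist0 v)
dist0-⊕-unit (i , inj₁ refl) = dist0-⊕-e i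
dist0-⊕-unit (i , inj₂ refl) = dist0-⊕-neg-e i

suc-suc-%2 : ∀ n → suc (suc n) % 2 ≡ n % 2
suc-suc-%2 n = trans (cong (_% 2) (ℕ.+-comm 2 n)) ([m+n]%n≡m%n n 2)

suc-%2 : ∀ n → suc n % 2 ≡ 1 ∸ n % 2
suc-%2 0 = refl
suc-%2 1 = refl
suc-%2 (suc (suc n)) =
  trans (suc-suc-%2 (suc n)) (trans (suc-%2 n) (cong (1 ∸_) (sym (suc-suc-%2 n))))

DifferByOne-%2 : ∀ {a b} → DifferByOne a b → a % 2 ≡ 1 ∸ b % 2
DifferByOne-%2 (up n)   = suc-%2 n
DifferByOne-%2 (down n) =
  sym (trans (cong (1 ∸_) (suc-%2 n)) (ℕ.m∸[m∸n]≡n (ℕ.<⇒≤pred (m%n<n n 2))))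

%2≢1⇒%2≡0 : ∀ n → n % 2 ≢ 1 → n % 2 ≡ 0
%2≢1⇒%2≡0 n ≢1 with n % 2 | m%n<n n 2
... | 0           | _            = refl
... | 1           | _            = ⊥-elim (≢1 refl)
... | suc (suc _) | s≤s (s≤s ())

IsOdd-⊕-unit : {t : Point d} → IsUnit t → (v : Point d) → IsOdd v → IsEven (v ⊕ t)
IsOdd-⊕-unit t-unit v odd = trans (DifferByOne-%2 (dist0-⊕-unit t-unit v)) (cong (1 ∸_) odd)

IsEven-⊕-unit : {t : Point d} → IsUnit t → (v : Point d) → IsEven v → IsOdd (v ⊕ t)
IsEven-⊕-unit t-unit v even = trans (DifferByOne-%2 (dist0-⊕-unit t-unit v)) (cong (1 ∸_) even)

∁IsOdd≐IsEven : ∁ IsOdd ≐ IsEven {d}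
∁IsOdd≐IsEven = (λ {v} → %2≢1⇒%2≡0 (dist0 v)) , λ even odd → ℕ.0≢1+n (trans (sym even) odd)

module OddSetCounting {d : ℕ} {U : List (Point d)} (U-unique : Unique U) (U-odd : OddSet U) where

  odd? : Decidable (IsOdd {d})
  odd? v = dist0 v % 2 ℕ.≟ 1

  even? : Decidable (IsEven {d})
  even? v = dist0 v % 2 ℕ.≟ 0

  inward? : (s : Point d) → Decidable (λ v → (v ⊕ s) ∈ U)
  inward? s v = (v ⊕ s) ∈? U

  even⇒neighbour∈ : ∀ {v t} → v ∈ U → IsEven v → IsUnit t → (v ⊕ t) ∈ U
  even⇒neighbour∈ {v} {t} v∈U even t-unit with (v ⊕ t) ∈? U
  ... | yes v⊕t∈U = v⊕t∈U
  ... | no  v⊕t∉U = ⊥-elim (proj₂ (∁IsOdd≐IsEven {d}) {v} even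
    (U-odd v (v ⊕ t) v∈U v⊕t∉U (subst IsUnit (sym (⊕-neg-cancelˡ v t)) t-unit)))

  length≡oddCard+evenCard : length U ≡ oddCard U + evenCard U
  length≡oddCard+evenCard = trans (length-filter-partition odd? U)
    (cong (λ ys → oddCard U + length ys) (filter-≐ (∁? odd?) even? ∁IsOdd≐IsEven U))

  module _ {s : Point d} (s-unit : IsUnit s) where

    private
      inward : List (Point d)
      inward = filter (inward? s) U

    length-filter-even-inward : length (filter even? inward) ≡ evenCard U
    length-filter-even-inward = unique∧set⇒length≡
      (Unique.filter⁺ even? (Unique.filter⁺ (inward? s) U-unique))
      (Unique.filter⁺ even? U-unique)
      (mk⇔ to from)
      where
      to : ∀ {z} → z ∈ᴸ filter even? inward → z ∈ᴸ filter even? U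
      to z∈ = let z∈inward , even = ∈-filter⁻ even? {xs = inward} z∈ in
        ∈-filter⁺ even? (proj₁ (∈-filter⁻ (inward? s) {xs = U} z∈inward)) even
      from : ∀ {z} → z ∈ᴸ filter even? U → z ∈ᴸ filter even? inward
      from z∈ = let z∈U , even = ∈-filter⁻ even? {xs = U} z∈ in
        ∈-filter⁺ even? (∈-filter⁺ (inward? s) z∈U (even⇒neighbour∈ z∈U even s-unit)) even

    length-filter-odd-inward : length (filter odd? inward) ≡ evenCard U
    length-filter-odd-inward = trans (sym (length-map (_⊕ s) (filter odd? inward)))
      (unique∧set⇒length≡
        (Unique.map⁺ (⊕-injectiveˡ s) (Unique.filter⁺ odd? (Unique.filter⁺ (inward? s) U-unique)))
        (Unique.filter⁺ even? U-unique)
        (mk⇔ to from))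
      where
      to : ∀ {z} → z ∈ᴸ map (_⊕ s) (filter odd? inward) → z ∈ᴸ filter even? U
      to z∈ with ∈-map⁻ (_⊕ s) z∈
      ... | v , v∈ , refl = let v∈inward , odd = ∈-filter⁻ odd? {xs = inward} v∈ in
        ∈-filter⁺ even? (proj₂ (∈-filter⁻ (inward? s) {xs = U} v∈inward)) (IsOdd-⊕-unit s-unit v odd)
      from : ∀ {z} → z ∈ᴸ filter even? U → z ∈ᴸ map (_⊕ s) (filter odd? inward)
      from {z} z∈ = subst (_∈ᴸ map (_⊕ s) (filter odd? inward)) (neg-⊕-cancelʳ z s)
        (∈-map⁺ (_⊕ s) (∈-filter⁺ odd? z-s∈inward (IsEven-⊕-unit (IsUnit-neg s-unit) z even)))
        where
        z∈U = proj₁ (∈-filter⁻ even? {xs = U} z∈)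
        even = proj₂ (∈-filter⁻ even? {xs = U} z∈)
        z-s∈inward : z ⊕ neg s ∈ᴸ inward
        z-s∈inward = ∈-filter⁺ (inward? s) (even⇒neighbour∈ z∈U even (IsUnit-neg s-unit))
          (subst (_∈ U) (sym (neg-⊕-cancelʳ z s)) z∈U)

    length-inward : length inward ≡ evenCard U + evenCard U
    length-inward = begin
      length inward
        ≡⟨ length-filter-partition odd? inward ⟩
      length (filter odd? inward) + length (filter (∁? odd?) inward)
        ≡⟨ cong (λ ys → length (filter odd? inward) + length ys)
                (filter-≐ (∁? odd?) even? ∁IsOdd≐IsEven inward) ⟩
      length (filter odd? inward) + length (filter even? inward)
        ≡⟨ cong₂ _+_ length-filter-odd-inward length-filter-even-inward ⟩
      evenCard U + evenCard U ∎
      where open ≡-Reasoning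

    ∂ˢcard+evenCard≡oddCard : ∂ˢcard s U + evenCard U ≡ oddCard U
    ∂ˢcard+evenCard≡oddCard = ℕ.+-cancelʳ-≡ E (∂ˢ + E) O (begin
      (∂ˢ + E) + E       ≡⟨ ℕ.+-assoc ∂ˢ E E ⟩
      ∂ˢ + (E + E)       ≡⟨ ℕ.+-comm ∂ˢ (E + E) ⟩
      (E + E) + ∂ˢ       ≡⟨ cong (_+ ∂ˢ) length-inward ⟨
      length inward + ∂ˢ ≡⟨ length-filter-partition (inward? s) U ⟨
      length U           ≡⟨ length≡oddCard+evenCard ⟩
      O + E              ∎)
      where
      open ≡-Reasoning
      ∂ˢ = ∂ˢcard s U
      E = evenCard U
      O = oddCard U

lemma1p3 : (d : ℕ) → 1 ≤ d → (U : List (Point d)) → Unique U → OddSet U →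
    (s : Point d) → IsUnit s →
    (+ ∂ˢcard s U ≡ + oddCard U - + evenCard U) × (∂card U ≡ (2 * d) * ∂ˢcard s U)
lemma1p3 d _ U U-unique U-odd s s-unit = ∂ˢcard≡oddCard-evenCard , ∂card≡2d∂ˢcard
  where
  open OddSetCounting U-unique U-odd
  c = ∂ˢcard s U

  ∂ˢcard≡oddCard-evenCard : + c ≡ + oddCard U - + evenCard U
  ∂ˢcard≡oddCard-evenCard = subst (λ o → + c ≡ + o - + evenCard U)
    (∂ˢcard+evenCard≡oddCard s-unit) (sym (//-rightDividesʳ (+ evenCard U) (+ c)))

  ∂ˢcard-unit : ∀ {t} → IsUnit t → ∂ˢcard t U ≡ c
  ∂ˢcard-unit t-unit = ℕ.+-cancelʳ-≡ (evenCard U) _ _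
    (trans (∂ˢcard+evenCard≡oddCard t-unit) (sym (∂ˢcard+evenCard≡oddCard s-unit)))

  ∂card≡2d∂ˢcard : ∂card U ≡ (2 * d) * c
  ∂card≡2d∂ˢcard = begin
    ∂card U                                ≡⟨ length-filter-pairs _ U (units d) ⟩
    sum (map (λ t → ∂ˢcard t U) (units d)) ≡⟨ cong sum (map-cong-local (All.map ∂ˢcard-unit units-IsUnit)) ⟩
    sum (map (λ _ → c) (units d))          ≡⟨ sum-map-const c (units d) ⟩
    length (units d) * c                   ≡⟨ cong (_* c) (length-units d) ⟩
    (2 * d) * c                            ∎
    where open ≡-Reasoning
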